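{- Let $O=\{o_1,\ldots,o_r\}$ and $V=\{v_1,\ldots,v_n\}$ be disjoint sets of labeled vertices, and let $T$ be an $O$-rooted labeled $r$-tree on $O\cup V$. A rearrangement $\nu$ of $v_1,\ldots,v_n$ is valid for $T$ if and only if $v_s$ precedes $v_t$ in $\nu$ whenever $v_s\in F_T(v_t)$.
   Context: An $O$-rooted labeled $r$-tree on $O\cup V$ is a graph $T$ on $O\cup V$ admitting a valid rearrangement. A valid rearrangement is an ordering $\nu=(v_{i_1},\ldots,v_{i_n})$ of $v_1,\ldots,v_n$ such that, for each $j\in[n]$, $v_{i_j}$ is adjacent to exactly $r$ vertices of $\{o_1,\ldots,o_r,v_{i_1},\ldots,v_{i_{j-1}}\}$, and these $r$ vertices are mutually adjacent in $T$. These $r$ vertices form the father set $F_T^\nu(v_{i_j})$. The father set does not depend on the valid rearrangement $\nu$, and is denoted $F_T(v_i)$. -}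

module Defs where

open import Data.Nat using (ℕ; zero; suc; _+_; _<_)
open import Data.Bool using (Bool; true; false; _∧_; if_then_else_)
open import Data.Fin using (Fin; toℕ; zero; suc)
open import Data.Sum using (_⊎_; inj₁; inj₂)
open import Data.Product using (Σ; _×_; _,_)
open import Data.Fin.Permutation using (Permutation′; _⟨$⟩ʳ_; _⟨$⟩ˡ_)
open import Relation.Binary.PropositionalEquality using (_≡_; _≢_)
open import Relation.Nullary.Decidable using (⌊_⌋)
import Data.Nat as ℕ

-- Vertex set O ∪ V with O = {o_1..o_r} (inj₁) and V = {v_1..v_n} (inj₂), disjoint.
Vertex : ℕ → ℕ → Set
Vertex r n = Fin r ⊎ Fin n

record Graph (r n : ℕ) : Set where
  field
    adj     : Vertex r n → Vertex r n → Bool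
    adj-sym : ∀ u w → adj u w ≡ adj w u
    adj-irr : ∀ u → adj u u ≡ false
open Graph public

count : ∀ {m} → (Fin m → Bool) → ℕ
count {zero}  f = 0
count {suc m} f = (if f zero then 1 else 0) + count (λ i → f (suc i))

-- A rearrangement ν of v_1..v_n : position j ↦ vertex ν ⟨$⟩ʳ j (so ν = (v_{i_1},…,v_{i_n})).
-- The position of vertex v in ν is ν ⟨$⟩ˡ v.

Before : ∀ {r n} → Permutation′ n → Fin n → Vertex r n → Bool
Before ν j (inj₁ o) = true
Before ν j (inj₂ v) = ⌊ toℕ (ν ⟨$⟩ˡ v) ℕ.<? toℕ j ⌋

FatherB : ∀ {r n} → Graph r n → Permutation′ n → Fin n → Vertex r n → Bool
FatherB T ν j u = Before ν j u ∧ adj T (inj₂ (ν ⟨$⟩ʳ j)) u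

fatherCount : ∀ {r n} → Graph r n → Permutation′ n → Fin n → ℕ
fatherCount T ν j = count (λ o → FatherB T ν j (inj₁ o)) + count (λ v → FatherB T ν j (inj₂ v))

Valid : ∀ {r n} → Graph r n → Permutation′ n → Set
Valid {r} T ν = ∀ j →
  (fatherCount T ν j ≡ r) ×
  (∀ u w → FatherB T ν j u ≡ true → FatherB T ν j w ≡ true → u ≢ w → adj T u w ≡ true)

IsRTree : ∀ {r n} → Graph r n → Set
IsRTree {n = n} T = Σ (Permutation′ n) (Valid T)

-- Father set F_T(v) of an r-tree, computed from the valid rearrangement witnessing
-- that T is an r-tree (the paper shows it does not depend on the choice).
InFatherSet : ∀ {r n} (T : Graph r n) → IsRTree T → Fin n → Vertex r n → Set
InFatherSet T (μ , _) v u = FatherB T μ (μ ⟨$⟩ˡ v) u ≡ true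

-- Write F_ν(x) for the set of neighbours of x that precede it in an ordering ν
-- (all of its root neighbours, together with the earlier inner ones); ν is valid iff every
-- F_ν(x) is an r-clique. If every father (for a valid μ) precedes its child in ν, then
-- F_ν(x) = F_μ(x) for all x, so ν is valid. Conversely, for two valid orderings μ and ν,
-- F_ν(x) ⊆ F_μ(x) by descending induction on the μ-position of x: a vertex v of
-- F_ν(x) \ F_μ(x) would be a μ-later neighbour, so x ∈ F_μ(v) = F_ν(v), i.e. x precedes v
-- in ν, which is absurd. Both sets have r elements, so they coincide, and the fathers
-- F_μ(t) of t precede t in ν.
module Submission where

open import Defs
import Data.Nat as ℕ
open import Data.Nat using (ℕ; _<_; _+_; _≤_; z≤n; s≤s)
open import Data.Nat.Properties using (m≤n⇒m≤1+n; m<n⇒m<1+n; <-irrefl; <-asym; <-cmp; +-cancelˡ-≡)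
open import Data.Bool using (Bool; true; false; _∧_)
open import Data.Bool.Properties using (T-≡)
open import Data.Fin using (Fin; toℕ; zero; suc; _>_)
open import Data.Fin.Properties using (toℕ-injective)
open import Data.Fin.Induction using (>-wellFounded)
open import Data.Fin.Permutation using (Permutation′; _⟨$⟩ʳ_; _⟨$⟩ˡ_; inverseʳ; inverseˡ)
open import Data.Sum using (_⊎_; inj₁; inj₂)
open import Data.Product using (_×_; _,_; proj₁; proj₂)
open import Data.Empty using (⊥; ⊥-elim)
open import Function using (_∘_)
open import Function.Bundles using (_⇔_; mk⇔; Equivalence)
open import Induction.WellFounded using (Acc; acc)
open import Relation.Binary using (tri<; tri≈; tri>)
open import Relation.Binary.PropositionalEquality
open import Relation.Nullary.Decidable using (⌊_⌋; dec-true; isYes≗does; toWitness)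

open Equivalence using (to; from)

bool-ext : ∀ {a b : Bool} → (a ≡ true → b ≡ true) → (b ≡ true → a ≡ true) → a ≡ b
bool-ext {false} {false} _ _ = refl
bool-ext {false} {true}  _ b⇒a = b⇒a refl
bool-ext {true}  {false} a⇒b _ = sym (a⇒b refl)
bool-ext {true}  {true}  _ _ = refl

∧≡true⇔ : ∀ {a b : Bool} → a ∧ b ≡ true ⇔ (a ≡ true × b ≡ true)
∧≡true⇔ {true} = mk⇔ (refl ,_) proj₂
∧≡true⇔ {false} = mk⇔ (λ ()) (λ ())

⌊<?⌋≡true⇔< : ∀ {m n : ℕ} → ⌊ m ℕ.<? n ⌋ ≡ true ⇔ m < n
⌊<?⌋≡true⇔< {m} {n} =
  mk⇔ (toWitness ∘ from T-≡) (λ m<n → trans (isYes≗does (m ℕ.<? n)) (dec-true (m ℕ.<? n) m<n))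

_⊆ᵇ_ : ∀ {m} → (Fin m → Bool) → (Fin m → Bool) → Set
f ⊆ᵇ g = ∀ i → f i ≡ true → g i ≡ true

count-cong : ∀ {m} {f g : Fin m → Bool} → (∀ i → f i ≡ g i) → count f ≡ count g
count-cong {ℕ.zero}  f≗g = refl
count-cong {ℕ.suc m} f≗g rewrite f≗g zero = cong (_ +_) (count-cong (f≗g ∘ suc))

count-mono : ∀ {m} (f g : Fin m → Bool) → f ⊆ᵇ g → count f ≤ count g
count-mono {ℕ.zero}  f g f⊆g = z≤n
count-mono {ℕ.suc m} f g f⊆g with f zero in f₀ | g zero in g₀
... | true  | true  = s≤s (count-mono _ _ (f⊆g ∘ suc))
... | true  | false with () ← trans (sym (f⊆g zero f₀)) g₀
... | false | true  = m≤n⇒m≤1+n (count-mono _ _ (f⊆g ∘ suc))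
... | false | false = count-mono _ _ (f⊆g ∘ suc)

count-strict : ∀ {m} (f g : Fin m → Bool) → f ⊆ᵇ g →
               ∀ k → g k ≡ true → f k ≡ false → count f < count g
count-strict f g f⊆g zero g₀ f₀ rewrite g₀ | f₀ = s≤s (count-mono _ _ (f⊆g ∘ suc))
count-strict f g f⊆g (suc k) gₖ fₖ with f zero in f₀ | g zero in g₀
... | true  | true  = s≤s (count-strict _ _ (f⊆g ∘ suc) k gₖ fₖ)
... | true  | false with () ← trans (sym (f⊆g zero f₀)) g₀
... | false | true  = m<n⇒m<1+n (count-strict _ _ (f⊆g ∘ suc) k gₖ fₖ)
... | false | false = count-strict _ _ (f⊆g ∘ suc) k gₖ fₖ

⊆ᵇ-count-≡⇒⊇ᵇ : ∀ {m} (f g : Fin m → Bool) → f ⊆ᵇ g → count f ≡ count g → g ⊆ᵇ f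
⊆ᵇ-count-≡⇒⊇ᵇ f g f⊆g #f≡#g i gᵢ with f i in fᵢ
... | true  = refl
... | false = ⊥-elim (<-irrefl #f≡#g (count-strict f g f⊆g i gᵢ fᵢ))

module _ {r n : ℕ} (T : Graph r n) where

  Adj : Vertex r n → Vertex r n → Set
  Adj u w = adj T u w ≡ true

  _≺⟨_⟩_ : Fin n → Permutation′ n → Fin n → Set
  v ≺⟨ ν ⟩ x = toℕ (ν ⟨$⟩ˡ v) < toℕ (ν ⟨$⟩ˡ x)

  Father : Permutation′ n → Fin n → Vertex r n → Bool
  Father ν x = FatherB T ν (ν ⟨$⟩ˡ x)

  father-root : ∀ ν x o → Father ν x (inj₁ o) ≡ adj T (inj₂ x) (inj₁ o)
  father-root ν x o rewrite inverseʳ ν {x} = refl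

  father-roots-agree : ∀ μ ν x o → Father μ x (inj₁ o) ≡ Father ν x (inj₁ o)
  father-roots-agree μ ν x o = trans (father-root μ x o) (sym (father-root ν x o))

  father-inner : ∀ ν x v → Father ν x (inj₂ v) ≡ true ⇔ (Adj (inj₂ x) (inj₂ v) × v ≺⟨ ν ⟩ x)
  father-inner ν x v rewrite inverseʳ ν {x} =
    mk⇔ (λ f → let b , a = to ∧≡true⇔ f in a , to ⌊<?⌋≡true⇔< b)
        (λ (a , v≺x) → from ∧≡true⇔ (from ⌊<?⌋≡true⇔< v≺x , a))

  father-asym : ∀ ν x v → Father ν x (inj₂ v) ≡ true → Father ν v (inj₂ x) ≡ true → ⊥
  father-asym ν x v fxv fvx =
    <-asym (proj₂ (to (father-inner ν x v) fxv)) (proj₂ (to (father-inner ν v x) fvx))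

  Adj-sym : ∀ {u w} → Adj u w → Adj w u
  Adj-sym {u} {w} a = trans (adj-sym T w u) a

  adj⇒≢ : ∀ {u w} → Adj u w → u ≢ w
  adj⇒≢ {u} a refl with () ← trans (sym a) (adj-irr T u)

  position-injective : ∀ (ν : Permutation′ n) {v x} → toℕ (ν ⟨$⟩ˡ v) ≡ toℕ (ν ⟨$⟩ˡ x) → v ≡ x
  position-injective ν pos≡ =
    trans (sym (inverseʳ ν)) (trans (cong (ν ⟨$⟩ʳ_) (toℕ-injective pos≡)) (inverseʳ ν))

  father-or-child : ∀ ν x v → Adj (inj₂ x) (inj₂ v) →
                    Father ν x (inj₂ v) ≡ true ⊎ Father ν v (inj₂ x) ≡ true
  father-or-child ν x v a with <-cmp (toℕ (ν ⟨$⟩ˡ v)) (toℕ (ν ⟨$⟩ˡ x))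
  ... | tri< v≺x _ _ = inj₁ (from (father-inner ν x v) (a , v≺x))
  ... | tri≈ _ pos≡ _ = ⊥-elim (adj⇒≢ a (cong inj₂ (sym (position-injective ν pos≡))))
  ... | tri> _ _ x≺v = inj₂ (from (father-inner ν v x) (Adj-sym a , x≺v))

  ValidFathers : (Vertex r n → Bool) → Set
  ValidFathers F = (count (F ∘ inj₁) + count (F ∘ inj₂) ≡ r)
                 × (∀ u w → F u ≡ true → F w ≡ true → u ≢ w → Adj u w)

  validFathers-cong : ∀ {F G} → (∀ u → F u ≡ G u) → ValidFathers F → ValidFathers G
  validFathers-cong F≗G (#F≡r , clique) =
    trans (cong₂ _+_ (count-cong (sym ∘ F≗G ∘ inj₁)) (count-cong (sym ∘ F≗G ∘ inj₂))) #F≡r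
    , λ u w Gu Gw u≢w → clique u w (trans (F≗G u) Gu) (trans (F≗G w) Gw) u≢w

  valid⇒validFathers : ∀ {ν} → Valid T ν → ∀ x → ValidFathers (Father ν x)
  valid⇒validFathers {ν} valid x = valid (ν ⟨$⟩ˡ x)

  validFathers⇒valid : ∀ {ν} → (∀ x → ValidFathers (Father ν x)) → Valid T ν
  validFathers⇒valid {ν} valid j = subst (ValidFathers ∘ FatherB T ν) (inverseˡ ν) (valid (ν ⟨$⟩ʳ j))

  FathersPrecede : Permutation′ n → Permutation′ n → Set
  FathersPrecede μ ν = ∀ s t → Father μ t (inj₂ s) ≡ true → s ≺⟨ ν ⟩ t

  fathers-agree : ∀ μ ν → FathersPrecede μ ν → ∀ x u → Father μ x u ≡ Father ν x u
  fathers-agree μ ν _ x (inj₁ o) = father-roots-agree μ ν x o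
  fathers-agree μ ν precedes x (inj₂ v) = bool-ext μ⇒ν ν⇒μ
    where
    μ⇒ν : Father μ x (inj₂ v) ≡ true → Father ν x (inj₂ v) ≡ true
    μ⇒ν fμ = from (father-inner ν x v) (proj₁ (to (father-inner μ x v) fμ) , precedes v x fμ)
    ν⇒μ : Father ν x (inj₂ v) ≡ true → Father μ x (inj₂ v) ≡ true
    ν⇒μ fν with father-or-child μ x v (proj₁ (to (father-inner ν x v) fν))
    ... | inj₁ fμ = fμ
    ... | inj₂ fμvx = ⊥-elim (<-asym (proj₂ (to (father-inner ν x v) fν)) (precedes x v fμvx))

  module _ {μ ν : Permutation′ n} (valid-μ : Valid T μ) (valid-ν : Valid T ν) where

    inner-fathers-⊆⇒⊇ : ∀ x → (Father ν x ∘ inj₂) ⊆ᵇ (Father μ x ∘ inj₂) →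
                        (Father μ x ∘ inj₂) ⊆ᵇ (Father ν x ∘ inj₂)
    inner-fathers-⊆⇒⊇ x ν⊆μ = ⊆ᵇ-count-≡⇒⊇ᵇ _ _ ν⊆μ (+-cancelˡ-≡ _ _ _ (begin
      count (Father μ x ∘ inj₁) + count (Father ν x ∘ inj₂)
        ≡⟨ cong (_+ _) (count-cong (father-roots-agree μ ν x)) ⟩
      count (Father ν x ∘ inj₁) + count (Father ν x ∘ inj₂)
        ≡⟨ proj₁ (valid⇒validFathers valid-ν x) ⟩
      r
        ≡⟨ proj₁ (valid⇒validFathers valid-μ x) ⟨
      count (Father μ x ∘ inj₁) + count (Father μ x ∘ inj₂) ∎))
      where open ≡-Reasoning

    inner-fathers-⊆ : ∀ x → Acc _>_ (μ ⟨$⟩ˡ x) → (Father ν x ∘ inj₂) ⊆ᵇ (Father μ x ∘ inj₂)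
    inner-fathers-⊆ x (acc later) v fν with father-or-child μ x v (proj₁ (to (father-inner ν x v) fν))
    ... | inj₁ fμ = fμ
    ... | inj₂ fμvx = ⊥-elim (father-asym ν x v fν (inner-fathers-⊆⇒⊇ v ν⊆μ-at-v x fμvx))
      where
      ν⊆μ-at-v : (Father ν v ∘ inj₂) ⊆ᵇ (Father μ v ∘ inj₂)
      ν⊆μ-at-v = inner-fathers-⊆ v (later (proj₂ (to (father-inner μ v x) fμvx)))

    fathers-unique : ∀ x u → Father μ x u ≡ Father ν x u
    fathers-unique x (inj₁ o) = father-roots-agree μ ν x o
    fathers-unique x (inj₂ v) =
      bool-ext (inner-fathers-⊆⇒⊇ x ν⊆μ v) (ν⊆μ v)
      where
      ν⊆μ : (Father ν x ∘ inj₂) ⊆ᵇ (Father μ x ∘ inj₂)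
      ν⊆μ = inner-fathers-⊆ x (>-wellFounded _)

proposition3p4 : ∀ {r n : ℕ} (T : Graph r n) (isTree : IsRTree T) (ν : Permutation′ n) →
    (Valid T ν → ∀ (s t : Fin n) → InFatherSet T isTree t (inj₂ s) → toℕ (ν ⟨$⟩ˡ s) < toℕ (ν ⟨$⟩ˡ t))
    × ((∀ (s t : Fin n) → InFatherSet T isTree t (inj₂ s) → toℕ (ν ⟨$⟩ˡ s) < toℕ (ν ⟨$⟩ˡ t)) → Valid T ν)
proposition3p4 T (μ , valid-μ) ν = fathers-precede , precede⇒valid
  where
  fathers-precede : Valid T ν → FathersPrecede T μ ν
  fathers-precede valid-ν s t fμ =
    proj₂ (to (father-inner T ν t s) (trans (sym (fathers-unique T valid-μ valid-ν t (inj₂ s))) fμ))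
  precede⇒valid : FathersPrecede T μ ν → Valid T ν
  precede⇒valid precedes = validFathers⇒valid T λ x →
    validFathers-cong T (fathers-agree T μ ν precedes x) (valid⇒validFathers T valid-μ x)
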